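{- Every maximal peak-pit Condorcet domain is directly connected.
   Context: Let $A$ be a finite set and $\mathcal L(A)$ the set of linear orders on $A$, written as words from top to bottom. For a domain $\mathcal D\subseteq\mathcal L(A)$ and $B\subseteq A$, $\mathcal D_B$ is the set of restrictions to $B$ of orders in $\mathcal D$. For distinct $a,b,c$, $x\in\{a,b,c\}$, $k\in\{1,2,3\}$, $\mathcal D_{\{a,b,c\}}$ satisfies $xN_{\{a,b,c\}}k$ if no order in $\mathcal D_{\{a,b,c\}}$ has $x$ in position $k$. $\mathcal D$ is a peak-pit Condorcet domain if for every triple of distinct alternatives, $\mathcal D_{\{a,b,c\}}$ satisfies $xN_{\{a,b,c\}}1$ or $xN_{\{a,b,c\}}3$ for some $x\in\{a,b,c\}$. A peak-pit Condorcet domain $\mathcal D\subseteq\mathcal L(A)$ is a maximal peak-pit Condorcet domain if every peak-pit Condorcet domain $\mathcal D'\subseteq\mathcal L(A)$ containing $\mathcal D$ equals $\mathcal D$. Two linear orders are alike if they differ by swapping two alternatives in adjacent positions; a path connecting $R$ and $T$ is a sequence $(R_1,\dots,R_k)$, $R_1=R$, $R_k=T$, consecutive orders alike; a geodesic is such a path of minimum length. $\mathcal D$ is directly connected if any two of its orders are connected by a geodesic all of whose orders lie in $\mathcal D$. -}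

module Defs where

open import Data.Nat using (ℕ; zero; suc; _≤_)
open import Data.Fin using (Fin; _≟_)
open import Data.List using (List; []; _∷_; filter; head; last; length)
open import Data.List.Membership.Propositional using (_∈_)
import Data.List.Membership.DecPropositional as DMP
open import Data.List.Relation.Unary.All using (All)
open import Data.List.Relation.Unary.Unique.Propositional using (Unique)
open import Data.List.Relation.Binary.Subset.Propositional using (_⊆_)
open import Data.Maybe using (Maybe; just; nothing)
open import Data.Product using (_×_; Σ; ∃-syntax)
open import Data.Sum using (_⊎_)
open import Relation.Binary.PropositionalEquality using (_≡_; _≢_)
open import Relation.Nullary using (¬_)

-- The finite set of alternatives is A = Fin n.
-- A word over A, read from top (first entry) to bottom (last entry).
Word : ℕ → Set
Word n = List (Fin n)

IsLinOrd : ∀ {n} → Word n → Set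
IsLinOrd {n} w = Unique w × (∀ (x : Fin n) → x ∈ w)

-- A domain is a finite set (list) of words; D ⊆ L(A) means All IsLinOrd D.
Domain : ℕ → Set
Domain n = List (Word n)

restrict : ∀ {n} → List (Fin n) → Word n → Word n
restrict {n} B w = filter (λ y → DMP._∈?_ (_≟_ {n}) y B) w

-- entry at 1-based position k (nothing if out of range)
atPos : ∀ {n} → Word n → ℕ → Maybe (Fin n)
atPos []      _             = nothing
atPos (x ∷ w) zero          = nothing
atPos (x ∷ w) (suc zero)    = just x
atPos (x ∷ w) (suc (suc k)) = atPos w (suc k)

NeverAt : ∀ {n} → Domain n → Fin n → Fin n → Fin n → Fin n → ℕ → Set
NeverAt D a b c x k = ∀ R → R ∈ D → ¬ (atPos (restrict (a ∷ b ∷ c ∷ []) R) k ≡ just x)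

PeakPit : ∀ {n} → Domain n → Set
PeakPit {n} D = ∀ (a b c : Fin n) → a ≢ b → a ≢ c → b ≢ c →
  ∃[ x ] ((x ≡ a ⊎ x ≡ b ⊎ x ≡ c) ×
          (NeverAt D a b c x 1 ⊎ NeverAt D a b c x 3))

-- maximal peak-pit Condorcet domain (D ⊆ L(A) is assumed separately)
MaximalPeakPit : ∀ {n} → Domain n → Set
MaximalPeakPit {n} D = PeakPit D ×
  (∀ (D' : Domain n) → All IsLinOrd D' → PeakPit D' → D ⊆ D' → D' ⊆ D)

data Alike {n} : Word n → Word n → Set where
  here : ∀ x y w → x ≢ y → Alike (x ∷ y ∷ w) (y ∷ x ∷ w)
  there : ∀ z {v w} → Alike v w → Alike (z ∷ v) (z ∷ w)

data Chain {n} : List (Word n) → Set where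
  single : ∀ R → Chain (R ∷ [])
  step : ∀ {R S rs} → Alike R S → Chain (S ∷ rs) → Chain (R ∷ S ∷ rs)

IsPath : ∀ {n} → Word n → Word n → List (Word n) → Set
IsPath R T ps = Chain ps × head ps ≡ just R × last ps ≡ just T

IsGeodesic : ∀ {n} → Word n → Word n → List (Word n) → Set
IsGeodesic {n} R T ps = IsPath R T ps ×
  (∀ (qs : List (Word n)) → IsPath R T qs → length ps ≤ length qs)

DirectlyConnected : ∀ {n} → Domain n → Set
DirectlyConnected {n} D = ∀ R T → R ∈ D → T ∈ D →
  ∃[ ps ] (IsGeodesic R T ps × All (_∈ D) ps)

-- Let inv(T, R) count the pairs that R and T order differently. Every step of a path changes inv(T, -)
-- by at most one, so a path from R to T has at least inv(T, R) + 1 orders, and it suffices to show: for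
-- distinct R, T in a maximal peak-pit domain D, swapping some adjacent pair of R that T orders the other
-- way leads to an order R′ of D.
--
-- Take any such pair. If D ∪ {R′} is still peak-pit, R′ ∈ D by maximality. Otherwise some triple
-- violates all six never-conditions in D ∪ {R′}, and a finite check over the orders of a triple shows
-- that D then contains an order P siding with R on one pair where R and T disagree and with T on
-- another. The pairwise majority M of R, T and P is a linear order satisfying every never-condition
-- of D, so M ∈ D; it differs from R, lies between R and T, and is strictly closer to R than T is.
-- By induction on that distance some adjacent swap of R towards M stays in D, and since M lies
-- between R and T it is also a swap towards T.

module Submission where

open import Defs
open import Data.Bool using (Bool; true; false; not; if_then_else_; _∧_; _∨_)
import Data.Bool.Properties as Boolₚ
open import Data.Fin using (Fin; _≟_)
open import Data.Fin.Patterns using (0F; 1F; 2F)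
open import Data.List using (List; []; _∷_; _++_; filter; map; length; allFin; cartesianProduct)
import Data.List.Membership.DecPropositional as DecMembership
open import Data.List.Membership.Propositional using (_∈_; _∉_; lose; find)
open import Data.List.Membership.Propositional.Properties
  using (∈-filter⁺; ∈-filter⁻; ∈-map⁺; ∈-map⁻; ∈-++⁺ʳ; ∈-allFin; ∈-cartesianProduct⁺)
open import Data.List.Properties using (filter-accept; filter-reject; filter-++; ≡-dec)
open import Data.List.Relation.Binary.Permutation.Propositional using (_↭_; prep; swap; ↭-refl; ↭-sym; ↭⇒↭ₛ)
open import Data.List.Relation.Binary.Permutation.Propositional.Properties using (∈-resp-↭)
import Data.List.Relation.Binary.Permutation.Setoid.Properties as PermutationSetoid
open import Data.List.Relation.Unary.All as All using (All; []; _∷_)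
open import Data.List.Relation.Unary.AllPairs as AllPairs using (AllPairs; []; _∷_)
open import Data.List.Relation.Unary.Any as Any using (Any; here; there)
open import Data.List.Relation.Unary.Sorted.TotalOrder.Properties using (Sorted⇒AllPairs)
open import Data.List.Relation.Unary.Unique.Propositional using (Unique)
import Data.List.Relation.Unary.Unique.Propositional.Properties as Uniqueₚ
import Data.List.Sort as Sort
open import Data.Maybe using (just)
import Data.Maybe as Maybe
import Data.Maybe.Properties as Maybeₚ
open import Data.Nat using (ℕ; zero; suc; _+_; _≤_; _<_; z≤n; s≤s)
open import Data.Nat.Properties
  using (≤-refl; ≤-trans; ≤-reflexive; ≤-pred; suc-injective; +-suc; +-mono-≤; +-monoˡ-≤; +-monoʳ-≤;
         +-mono-≤-<; +-mono-<-≤; m≤n+m; +-commutativeSemigroup; module ≤-Reasoning)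
open import Algebra.Properties.CommutativeSemigroup +-commutativeSemigroup using (x∙yz≈y∙xz)
open import Data.Product using (Σ; _×_; _,_; proj₁; proj₂; ∃; ∃-syntax)
open import Data.Sum using (_⊎_; inj₁; inj₂; [_,_]′)
import Data.Sum as Sum
open import Function using (id; _∘_; case_of_; Injective; _⇔_; mk⇔)
open import Level using (0ℓ)
open import Relation.Binary using (Rel; Trichotomous; tri<; tri≈; tri>; StrictTotalOrder; DecTotalOrder)
import Relation.Binary.Properties.StrictTotalOrder as StrictTotalOrderₚ
open import Relation.Binary.PropositionalEquality
  using (_≡_; _≢_; refl; sym; trans; cong; subst; setoid; isEquivalence; module ≡-Reasoning)
open import Relation.Nullary using (¬_; ¬?; Dec; yes; no; does; contradiction)
open import Relation.Nullary.Decidable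
  using (dec-true; dec-false; does-⇔; map′; from-yes; decidable-stable; _×-dec_; _⊎-dec_; _→-dec_)
open import Relation.Unary using (Pred; Decidable)

witness : ∀ {A : Set} (a? : Dec A) → does a? ≡ true → A
witness (yes a) _ = a

infix 4 _∈?_
_∈?_ : ∀ {n} (x : Fin n) (w : Word n) → Dec (x ∈ w)
_∈?_ = DecMembership._∈?_ _≟_

module _ {n : ℕ} where

  precedes : Word n → Fin n → Fin n → Bool
  precedes []      x y = false
  precedes (z ∷ w) x y with z ≟ x
  ... | yes _ = does (y ∈? w)
  ... | no _ with z ≟ y
  ...   | yes _ = false
  ...   | no _  = precedes w x y

  precedes-head : ∀ x y w → precedes (x ∷ w) x y ≡ does (y ∈? w)
  precedes-head x y w with x ≟ x
  ... | yes _   = refl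
  ... | no x≢x = contradiction refl x≢x

  precedes-second : ∀ {x y} w → x ≢ y → precedes (y ∷ w) x y ≡ false
  precedes-second {x} {y} w x≢y with y ≟ x
  ... | yes y≡x = contradiction (sym y≡x) x≢y
  ... | no _ with y ≟ y
  ...   | yes _   = refl
  ...   | no y≢y = contradiction refl y≢y

  precedes-skip : ∀ {z x y} w → z ≢ x → z ≢ y → precedes (z ∷ w) x y ≡ precedes w x y
  precedes-skip {z} {x} {y} w z≢x z≢y with z ≟ x
  ... | yes z≡x = contradiction z≡x z≢x
  ... | no _ with z ≟ y
  ...   | yes z≡y = contradiction z≡y z≢y
  ...   | no _    = refl

  precedes-∷-cong : ∀ z {v w x y} → y ∈ v ⇔ y ∈ w → precedes v x y ≡ precedes w x y →
                    precedes (z ∷ v) x y ≡ precedes (z ∷ w) x y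
  precedes-∷-cong z {v} {w} {x} {y} y∈v⇔y∈w eq with z ≟ x
  ... | yes _ = does-⇔ y∈v⇔y∈w (y ∈? v) (y ∈? w)
  ... | no _ with z ≟ y
  ...   | yes _ = refl
  ...   | no _  = eq

  precedes⇒∈ : ∀ w {x y} → precedes w x y ≡ true → x ∈ w × y ∈ w
  precedes⇒∈ (z ∷ w) {x} {y} xy with z ≟ x
  ... | yes refl = here refl , there (witness (y ∈? w) xy)
  ... | no _ with z ≟ y
  ...   | no _ = let x∈w , y∈w = precedes⇒∈ w xy in there x∈w , there y∈w

  precedes-AllPairs : ∀ {_≺_ : Rel (Fin n) 0ℓ} {w x y} → AllPairs _≺_ w → precedes w x y ≡ true → x ≺ y
  precedes-AllPairs {w = z ∷ w} {x} {y} (z≺w ∷ w↗) xy with z ≟ x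
  ... | yes refl = All.lookup z≺w (witness (y ∈? w) xy)
  ... | no _ with z ≟ y
  ...   | no _ = precedes-AllPairs w↗ xy

  AllPairs-precedes : ∀ {w} → Unique w → AllPairs (λ x y → precedes w x y ≡ true) w
  AllPairs-precedes {[]}    []          = []
  AllPairs-precedes {z ∷ w} (z≢w ∷ w!) =
    All.tabulate (λ {y} y∈w → trans (precedes-head z y w) (dec-true (y ∈? w) y∈w))
    ∷ AllPairs.map extend (AllPairs-precedes w!)
    where
    extend : ∀ {x y} → precedes w x y ≡ true → precedes (z ∷ w) x y ≡ true
    extend xy = let x∈w , y∈w = precedes⇒∈ w xy in
      trans (precedes-skip w (All.lookup z≢w x∈w) (All.lookup z≢w y∈w)) xy

  precedes-irrefl : ∀ {w} x → Unique w → precedes w x x ≡ false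
  precedes-irrefl {[]}    x _            = refl
  precedes-irrefl {z ∷ w} x (z≢w ∷ w!) = case z ≟ x of λ where
    (yes refl) → trans (precedes-head z z w) (dec-false (z ∈? w) (λ z∈w → All.lookup z≢w z∈w refl))
    (no z≢x)   → trans (precedes-skip w z≢x z≢x) (precedes-irrefl x w!)

  precedes-≢ : ∀ {w x y} → Unique w → precedes w x y ≡ true → x ≢ y
  precedes-≢ w! xy refl = contradiction (trans (sym xy) (precedes-irrefl _ w!)) λ ()

  precedes-flip : ∀ {w x y} → IsLinOrd w → x ≢ y → precedes w y x ≡ not (precedes w x y)
  precedes-flip (w! , ∈w) x≢y = flip w! (∈w _) (∈w _) x≢y
    where
    flip : ∀ {w x y} → Unique w → x ∈ w → y ∈ w → x ≢ y → precedes w y x ≡ not (precedes w x y)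
    flip {z ∷ w} {x} {y} (_ ∷ w!) x∈ y∈ x≢y = case ((z ≟ x) , (z ≟ y)) of λ where
      (yes refl , _) → trans (precedes-second w (x≢y ∘ sym))
        (cong not (sym (trans (precedes-head z y w) (dec-true (y ∈? w) (Any.tail (x≢y ∘ sym) y∈)))))
      (_ , yes refl) → trans (precedes-head z x w)
        (trans (dec-true (x ∈? w) (Any.tail x≢y x∈)) (cong not (sym (precedes-second w x≢y))))
      (no z≢x , no z≢y) → trans (precedes-skip w z≢y z≢x)
        (trans (flip w! (Any.tail (z≢x ∘ sym) x∈) (Any.tail (z≢y ∘ sym) y∈) x≢y)
               (cong not (sym (precedes-skip w z≢x z≢y))))

  precedes-asym : ∀ {w x y} → IsLinOrd w → precedes w x y ≡ true → precedes w y x ≡ false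
  precedes-asym w-lin xy = trans (precedes-flip w-lin (precedes-≢ (proj₁ w-lin) xy)) (cong not xy)

  precedes-adjacent : ∀ pre w {x y} → Unique (pre ++ x ∷ y ∷ w) → precedes (pre ++ x ∷ y ∷ w) x y ≡ true
  precedes-adjacent []        w {x} {y} _          =
    trans (precedes-head x y (y ∷ w)) (dec-true (y ∈? y ∷ w) (here refl))
  precedes-adjacent (z ∷ pre) w         (z≢ ∷ w!) =
    trans (precedes-skip _ (All.lookup z≢ (∈-++⁺ʳ pre (here refl)))
                           (All.lookup z≢ (∈-++⁺ʳ pre (there (here refl)))))
          (precedes-adjacent pre w w!)

  adjacent-distinct : ∀ pre w {x y} → Unique (pre ++ x ∷ y ∷ w) → x ≢ y
  adjacent-distinct pre w w! = precedes-≢ w! (precedes-adjacent pre w w!)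

  module _ {P : Pred (Fin n) 0ℓ} (P? : Decidable P) where

    precedes-filter : ∀ w {x y} → P x → P y → precedes (filter P? w) x y ≡ precedes w x y
    precedes-filter []      _  _  = refl
    precedes-filter (z ∷ w) {x} {y} px py = case P? z of λ where
      (yes pz) → trans (cong (λ v → precedes v x y) (filter-accept P? pz))
        (precedes-∷-cong z (mk⇔ (proj₁ ∘ ∈-filter⁻ P?) (λ y∈w → ∈-filter⁺ P? y∈w py))
                           (precedes-filter w px py))
      (no ¬pz) → trans (cong (λ v → precedes v x y) (filter-reject P? ¬pz))
        (trans (precedes-filter w px py) (sym (precedes-skip {z} w (λ { refl → ¬pz px }) (λ { refl → ¬pz py }))))

    filter-∷-cong : ∀ z {v w} → filter P? v ≡ filter P? w → filter P? (z ∷ v) ≡ filter P? (z ∷ w)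
    filter-∷-cong z eq with does (P? z)
    ... | true  = cong (z ∷_) eq
    ... | false = eq

    filter-swap : ∀ pre w {x y} → ¬ P x ⊎ ¬ P y →
                  filter P? (pre ++ x ∷ y ∷ w) ≡ filter P? (pre ++ y ∷ x ∷ w)
    filter-swap pre w {x} {y} ¬px⊎¬py rewrite filter-++ P? pre (x ∷ y ∷ w) | filter-++ P? pre (y ∷ x ∷ w) =
      cong (filter P? pre ++_) (swapped ¬px⊎¬py)
      where
      swapped : ¬ P x ⊎ ¬ P y → filter P? (x ∷ y ∷ w) ≡ filter P? (y ∷ x ∷ w)
      swapped (inj₁ ¬px) = trans (filter-reject P? ¬px) (sym (filter-∷-cong y (filter-reject P? ¬px)))
      swapped (inj₂ ¬py) = trans (filter-∷-cong x (filter-reject P? ¬py)) (sym (filter-reject P? ¬py))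

  precedes-swap-other : ∀ pre w {x y u v} → x ∉ u ∷ v ∷ [] ⊎ y ∉ u ∷ v ∷ [] →
                        precedes (pre ++ y ∷ x ∷ w) u v ≡ precedes (pre ++ x ∷ y ∷ w) u v
  precedes-swap-other pre w {x} {y} {u} {v} x∉⊎y∉ = begin
    precedes (pre ++ y ∷ x ∷ w) u v             ≡⟨ precedes-filter P? (pre ++ y ∷ x ∷ w) u∈uv v∈uv ⟨
    precedes (filter P? (pre ++ y ∷ x ∷ w)) u v ≡⟨ cong (λ l → precedes l u v)
                                                         (filter-swap P? pre w x∉⊎y∉) ⟨
    precedes (filter P? (pre ++ x ∷ y ∷ w)) u v ≡⟨ precedes-filter P? (pre ++ x ∷ y ∷ w) u∈uv v∈uv ⟩
    precedes (pre ++ x ∷ y ∷ w) u v             ∎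
    where
    open ≡-Reasoning
    P? = _∈? u ∷ v ∷ []
    u∈uv : u ∈ u ∷ v ∷ []
    u∈uv = here refl
    v∈uv : v ∈ u ∷ v ∷ []
    v∈uv = there (here refl)

  precedes-swap : ∀ pre w {x y} u v →
    precedes (pre ++ y ∷ x ∷ w) u v ≡ precedes (pre ++ x ∷ y ∷ w) u v
    ⊎ (u ≡ x × v ≡ y ⊎ u ≡ y × v ≡ x)
  precedes-swap pre w {x} {y} u v with x ∈? u ∷ v ∷ [] | y ∈? u ∷ v ∷ []
  ... | yes (here refl)         | yes (here refl)         = inj₁ refl
  ... | yes (here refl)         | yes (there (here refl)) = inj₂ (inj₁ (refl , refl))
  ... | yes (there (here refl)) | yes (here refl)         = inj₂ (inj₂ (refl , refl))
  ... | yes (there (here refl)) | yes (there (here refl)) = inj₁ refl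
  ... | no x∉uv                 | _                       = inj₁ (precedes-swap-other pre w (inj₁ x∉uv))
  ... | yes _                   | no y∉uv                 = inj₁ (precedes-swap-other pre w (inj₂ y∉uv))

  Alike⇒↭ : ∀ {v w : Word n} → Alike v w → v ↭ w
  Alike⇒↭ (here x y w _) = swap x y ↭-refl
  Alike⇒↭ (there z a)    = prep z (Alike⇒↭ a)

  alike-swap : ∀ pre w {x y : Fin n} → x ≢ y → Alike (pre ++ x ∷ y ∷ w) (pre ++ y ∷ x ∷ w)
  alike-swap []        w {x} {y} x≢y = here x y w x≢y
  alike-swap (z ∷ pre) w         x≢y = there z (alike-swap pre w x≢y)

  IsLinOrd-resp-↭ : ∀ {v w : Word n} → v ↭ w → IsLinOrd v → IsLinOrd w
  IsLinOrd-resp-↭ v↭w (v! , ∈v) =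
    PermutationSetoid.Unique-resp-↭ (setoid (Fin n)) (↭⇒↭ₛ v↭w) v! , λ x → ∈-resp-↭ v↭w (∈v x)

precedes-map : ∀ {m n} {f : Fin m → Fin n} → Injective _≡_ _≡_ f →
               ∀ w {x y} → precedes (map f w) (f x) (f y) ≡ precedes w x y
precedes-map f-inj []      = refl
precedes-map {f = f} f-inj (z ∷ w) {x} {y} = case z ≟ x of λ where
    (yes refl) → trans (precedes-head (f z) (f y) (map f w))
      (trans (does-⇔ (mk⇔ from-map (∈-map⁺ f)) (f y ∈? map f w) (y ∈? w)) (sym (precedes-head z y w)))
    (no z≢x) → case z ≟ y of λ where
      (yes refl) → trans (precedes-second (map f w) (z≢x ∘ sym ∘ f-inj)) (sym (precedes-second w (z≢x ∘ sym)))
      (no z≢y)   → trans (precedes-skip (map f w) (z≢x ∘ f-inj) (z≢y ∘ f-inj))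
        (trans (precedes-map f-inj w) (sym (precedes-skip w z≢x z≢y)))
  where
  from-map : f y ∈ map f w → y ∈ w
  from-map fy∈ with ∈-map⁻ f fy∈
  ... | u , u∈w , fy≡fu rewrite f-inj fy≡fu = u∈w

record AdjacentInversion {n} (R T : Word n) : Set where
  constructor adjacentInversion
  field
    pre w    : Word n
    {x y}    : Fin n
    split    : R ≡ pre ++ x ∷ y ∷ w
    reversed : precedes T y x ≡ true

  swapped : Word n
  swapped = pre ++ y ∷ x ∷ w

module _ {n : ℕ} where

  split-before : ∀ r {t : Fin n} {R} → t ∈ R → ∃[ pre ] ∃[ u ] ∃[ w ] r ∷ R ≡ pre ++ u ∷ t ∷ w
  split-before r {R = _ ∷ R} (here refl) = [] , r , R , refl
  split-before r {R = y ∷ _} (there t∈R) =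
    let pre , u , w , eq = split-before y t∈R in r ∷ pre , u , w , cong (r ∷_) eq

  adjacent-inversion : ∀ {R T : Word n} → Unique R → Unique T →
                       (∀ {z} → z ∈ R → z ∈ T) → (∀ {z} → z ∈ T → z ∈ R) → R ≢ T →
                       AdjacentInversion R T
  adjacent-inversion {[]}    {[]}    _ _ _ _ R≢T = contradiction refl R≢T
  adjacent-inversion {[]}    {_ ∷ _} _ _ _ T⊆R _ with () ← T⊆R (here refl)
  adjacent-inversion {_ ∷ _} {[]}    _ _ R⊆T _ _ with () ← R⊆T (here refl)
  adjacent-inversion {r ∷ R} {t ∷ T} (r≢R ∷ R!) (t≢T ∷ T!) R⊆T T⊆R R≢T with r ≟ t
  ... | yes refl =
    let adjacentInversion pre w split reversed =
          adjacent-inversion R! T! (tail-⊆ r≢R R⊆T) (tail-⊆ t≢T T⊆R) (R≢T ∘ cong (r ∷_))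
        fresh : ∀ {z} → z ∈ pre ++ _ ∷ _ ∷ w → r ≢ z
        fresh z∈ = All.lookup r≢R (subst (_ ∈_) (sym split) z∈)
    in adjacentInversion (r ∷ pre) w (cong (r ∷_) split)
         (trans (precedes-skip T (fresh (∈-++⁺ʳ pre (there (here refl)))) (fresh (∈-++⁺ʳ pre (here refl))))
                reversed)
    where
    tail-⊆ : ∀ {V W} → All (r ≢_) V → (∀ {z} → z ∈ r ∷ V → z ∈ r ∷ W) →
             ∀ {z} → z ∈ V → z ∈ W
    tail-⊆ r≢V V⊆W z∈V = Any.tail (λ z≡r → All.lookup r≢V z∈V (sym z≡r)) (V⊆W (there z∈V))
  ... | no r≢t =
    let pre , u , w , split = split-before r (Any.tail (r≢t ∘ sym) (T⊆R (here refl)))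
        u≢t = adjacent-distinct pre w (subst Unique split (r≢R ∷ R!))
        u∈T = Any.tail u≢t (R⊆T (subst (u ∈_) (sym split) (∈-++⁺ʳ pre (here refl))))
    in adjacentInversion pre w split (trans (precedes-head t u T) (dec-true (u ∈? T) u∈T))

  alike-swapped : ∀ {R T : Word n} → IsLinOrd R → (s : AdjacentInversion R T) →
                  Alike R (AdjacentInversion.swapped s)
  alike-swapped R-lin (adjacentInversion pre w refl _) = alike-swap pre w (adjacent-distinct pre w (proj₁ R-lin))

  swapped-linear : ∀ {R T : Word n} → IsLinOrd R → (s : AdjacentInversion R T) →
                   IsLinOrd (AdjacentInversion.swapped s)
  swapped-linear R-lin s = IsLinOrd-resp-↭ (Alike⇒↭ (alike-swapped R-lin s)) R-lin

  swap-changes-only-disagreements : ∀ {R T : Word n} → IsLinOrd R → IsLinOrd T → (s : AdjacentInversion R T) →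
    ∀ u v → precedes (AdjacentInversion.swapped s) u v ≡ precedes R u v ⊎ precedes R u v ≢ precedes T u v
  swap-changes-only-disagreements R-lin T-lin (adjacentInversion pre w refl yx) u v with precedes-swap pre w u v
  ... | inj₁ same                 = inj₁ same
  ... | inj₂ (inj₁ (refl , refl)) = inj₂ λ eq →
    contradiction (trans (sym (precedes-adjacent pre w (proj₁ R-lin))) (trans eq (precedes-asym T-lin yx))) λ ()
  ... | inj₂ (inj₂ (refl , refl)) = inj₂ λ eq →
    contradiction (trans (sym (precedes-asym R-lin (precedes-adjacent pre w (proj₁ R-lin)))) (trans eq yx)) λ ()

indicator : Bool → ℕ
indicator true  = 1
indicator false = 0

indicator-mono : ∀ {a b} → (a ≡ true → b ≡ true) → indicator a ≤ indicator b
indicator-mono {false}         _   = z≤n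
indicator-mono {true}  {true}  _   = ≤-refl
indicator-mono {true}  {false} a⇒b = contradiction (a⇒b refl) λ ()

module _ {n : ℕ} where

  placedBefore : Word n → Fin n → Word n → ℕ
  placedBefore T x []      = 0
  placedBefore T x (y ∷ w) = indicator (precedes T y x) + placedBefore T x w

  -- The Kendall tau distance: the pairs placed x before y by R and y before x by T.
  inversions : Word n → Word n → ℕ
  inversions T []      = 0
  inversions T (x ∷ w) = placedBefore T x w + inversions T w

  placedBefore-alike : ∀ T x {v w} → Alike v w → placedBefore T x v ≡ placedBefore T x w
  placedBefore-alike T x (here y z w _) = x∙yz≈y∙xz (indicator (precedes T y x)) (indicator (precedes T z x)) _
  placedBefore-alike T x (there z a)    = cong (indicator (precedes T z x) +_) (placedBefore-alike T x a)

  inversions-alike : ∀ T {v w} → Alike v w → inversions T v ≤ suc (inversions T w)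
  inversions-alike T (here x y w _) = begin
    (indicator (precedes T y x) + placedBefore T x w) + (placedBefore T y w + inversions T w)
      ≤⟨ +-monoˡ-≤ (placedBefore T y w + inversions T w)
           (+-monoˡ-≤ (placedBefore T x w) (indicator-mono {precedes T y x} {true} λ _ → refl)) ⟩
    suc (placedBefore T x w + (placedBefore T y w + inversions T w))
      ≡⟨ cong suc (x∙yz≈y∙xz (placedBefore T x w) (placedBefore T y w) (inversions T w)) ⟩
    suc (placedBefore T y w + (placedBefore T x w + inversions T w))
      ≤⟨ s≤s (+-monoˡ-≤ _ (m≤n+m _ (indicator (precedes T x y)))) ⟩
    suc ((indicator (precedes T x y) + placedBefore T y w) + (placedBefore T x w + inversions T w)) ∎
    where open ≤-Reasoning
  inversions-alike T (there z {v} {w} a) rewrite placedBefore-alike T z a =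
    ≤-trans (+-monoʳ-≤ (placedBefore T z w) (inversions-alike T a)) (≤-reflexive (+-suc _ _))

  inversions-swap : ∀ T pre w {x y} → x ≢ y → precedes T y x ≡ true → precedes T x y ≡ false →
                    inversions T (pre ++ x ∷ y ∷ w) ≡ suc (inversions T (pre ++ y ∷ x ∷ w))
  inversions-swap T []        w {x} {y} _ yx xy rewrite yx | xy =
    cong suc (x∙yz≈y∙xz (placedBefore T x w) (placedBefore T y w) (inversions T w))
  inversions-swap T (z ∷ pre) w x≢y yx xy
    rewrite placedBefore-alike T z (alike-swap pre w x≢y) | inversions-swap T pre w x≢y yx xy = +-suc _ _

  inversions-swapped : ∀ {R T} → IsLinOrd T → (s : AdjacentInversion R T) →
                       inversions T R ≡ suc (inversions T (AdjacentInversion.swapped s))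
  inversions-swapped {T = T} T-lin (adjacentInversion pre w refl yx) =
    inversions-swap T pre w (precedes-≢ (proj₁ T-lin) yx ∘ sym) yx (precedes-asym T-lin yx)

  placedBefore-zero : ∀ T x {w} → All (λ y → precedes T y x ≡ false) w → placedBefore T x w ≡ 0
  placedBefore-zero T x []          = refl
  placedBefore-zero T x (yx ∷ rest) rewrite yx = placedBefore-zero T x rest

  inversions-self : ∀ {T} → IsLinOrd T → inversions T T ≡ 0
  inversions-self T-lin = zero-on (AllPairs.map (precedes-asym T-lin) (AllPairs-precedes (proj₁ T-lin)))
    where
    zero-on : ∀ {T R} → AllPairs (λ x y → precedes T y x ≡ false) R → inversions T R ≡ 0
    zero-on {T} {[]}    []          = refl
    zero-on {T} {x ∷ R} (x≺R ∷ R↗) rewrite placedBefore-zero T x x≺R = zero-on R↗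

  path-length : ∀ {R T qs} → IsLinOrd T → IsPath R T qs → suc (inversions T R) ≤ length qs
  path-length T-lin (single _ , refl , refl) rewrite inversions-self T-lin = s≤s z≤n
  path-length {T = T} T-lin (step alike chain , refl , last≡T) =
    s≤s (≤-trans (inversions-alike T alike) (path-length T-lin (chain , refl , last≡T)))

  module _ (M T : Word n) where

    placedBefore-mono : ∀ x {w} → All (λ y → precedes M y x ≡ true → precedes T y x ≡ true) w →
                        placedBefore M x w ≤ placedBefore T x w
    placedBefore-mono x []       = z≤n
    placedBefore-mono x (h ∷ hs) = +-mono-≤ (indicator-mono h) (placedBefore-mono x hs)

    placedBefore-strict : ∀ x {w} → All (λ y → precedes M y x ≡ true → precedes T y x ≡ true) w →
                          Any (λ y → precedes M y x ≡ false × precedes T y x ≡ true) w →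
                          placedBefore M x w < placedBefore T x w
    placedBefore-strict x (_ ∷ hs) (here (yxM , yxT)) rewrite yxM | yxT = s≤s (placedBefore-mono x hs)
    placedBefore-strict x (h ∷ hs) (there s)          = +-mono-≤-< (indicator-mono h) (placedBefore-strict x hs s)

    inversions-mono : ∀ {R} → AllPairs (λ x y → precedes M y x ≡ true → precedes T y x ≡ true) R →
                      inversions M R ≤ inversions T R
    inversions-mono []       = z≤n
    inversions-mono (h ∷ hs) = +-mono-≤ (placedBefore-mono _ h) (inversions-mono hs)

    inversions-strict : ∀ {R x y} → AllPairs (λ x y → precedes M y x ≡ true → precedes T y x ≡ true) R →
                        precedes R x y ≡ true → precedes M y x ≡ false → precedes T y x ≡ true →
                        inversions M R < inversions T R
    inversions-strict {z ∷ R} {x} {y} (h ∷ hs) xy yxM yxT = case z ≟ x of λ where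
      (yes refl) → +-mono-<-≤
        (placedBefore-strict z h (lose (witness (y ∈? R) (trans (sym (precedes-head z y R)) xy)) (yxM , yxT)))
        (inversions-mono hs)
      (no z≢x) → case z ≟ y of λ where
        (yes refl) → contradiction (trans (sym xy) (precedes-second R (z≢x ∘ sym))) λ ()
        (no z≢y)   → +-mono-≤-< (placedBefore-mono z h)
                                (inversions-strict hs (trans (sym (precedes-skip R z≢x z≢y)) xy) yxM yxT)

module Linearisation {n : ℕ} (lt : Fin n → Fin n → Bool)
  (lt-irrefl : ∀ x → lt x x ≡ false)
  (lt-flip : ∀ {x y} → x ≢ y → lt y x ≡ not (lt x y))
  (lt-trans : ∀ {x y z} → lt x y ≡ true → lt y z ≡ true → lt x z ≡ true) where

  private
    lt-irreflexive : ∀ x → lt x x ≢ true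
    lt-irreflexive x xx = contradiction (trans (sym xx) (lt-irrefl x)) λ ()

    compare : Trichotomous _≡_ (λ x y → lt x y ≡ true)
    compare x y with x ≟ y
    ... | yes refl = tri≈ (lt-irreflexive x) refl (lt-irreflexive x)
    ... | no x≢y with lt x y in xy
    ...   | true  = tri< refl x≢y (λ yx → contradiction (trans (sym yx) (trans (lt-flip x≢y) (cong not xy))) λ ())
    ...   | false = tri> (λ ()) x≢y (trans (lt-flip x≢y) (cong not xy))

    strictTotalOrder : StrictTotalOrder 0ℓ 0ℓ 0ℓ
    strictTotalOrder = record
      { isStrictTotalOrder = record
        { isStrictPartialOrder = record
          { isEquivalence = isEquivalence
          ; irrefl        = λ { refl → lt-irreflexive _ }
          ; trans         = lt-trans
          ; <-resp-≈      = (λ { refl xy → xy }) , (λ { refl xy → xy })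
          }
        ; compare = compare
        }
      }

    decTotalOrder : DecTotalOrder 0ℓ 0ℓ 0ℓ
    decTotalOrder = StrictTotalOrderₚ.decTotalOrder strictTotalOrder

    open DecTotalOrder decTotalOrder using (totalOrder)
    open Sort decTotalOrder using (sort; sort-↭; sort-↗)

  linearisation : Word n
  linearisation = sort (allFin n)

  linearisation-linear : IsLinOrd linearisation
  linearisation-linear = IsLinOrd-resp-↭ (↭-sym (sort-↭ (allFin n))) (Uniqueₚ.allFin⁺ n , ∈-allFin)

  private
    ordered : ∀ {x y} → precedes linearisation x y ≡ true → x ≢ y → lt x y ≡ true
    ordered xy x≢y with precedes-AllPairs (Sorted⇒AllPairs totalOrder (sort-↗ (allFin n))) xy
    ... | inj₁ x<y = x<y
    ... | inj₂ x≡y = contradiction x≡y x≢y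

  precedes-linearisation : ∀ x y → precedes linearisation x y ≡ lt x y
  precedes-linearisation x y with x ≟ y
  ... | yes refl = trans (precedes-irrefl x (proj₁ linearisation-linear)) (sym (lt-irrefl x))
  ... | no x≢y with precedes linearisation x y in xy
  ...   | true  = sym (ordered xy x≢y)
  ...   | false = sym (trans (lt-flip (x≢y ∘ sym)) (cong not (ordered yx (x≢y ∘ sym))))
    where
    yx : precedes linearisation y x ≡ true
    yx = trans (precedes-flip linearisation-linear x≢y) (cong not xy)

majority : Bool → Bool → Bool → Bool
majority x y z = if x then y ∨ z else y ∧ z

majority-not : ∀ x y z → majority (not x) (not y) (not z) ≡ not (majority x y z)
majority-not true  true  z = refl
majority-not true  false z = refl
majority-not false true  z = refl
majority-not false false z = refl

majority-falseˡ : ∀ y z → majority false y z ≡ true → y ≡ true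
majority-falseˡ true  _ _ = refl
majority-falseˡ false _ ()

majorityOf : ∀ {n} → Word n → Word n → Word n → Fin n → Fin n → Bool
majorityOf R T P x y = majority (precedes R x y) (precedes T x y) (precedes P x y)

SidesWith : ∀ {n} → Word n → Word n → Word n → Set
SidesWith R T P = ∃[ x ] ∃[ y ] (precedes R x y ≡ true × precedes T x y ≡ false × precedes P x y ≡ true)

Splits : ∀ {n} → Word n → Word n → Word n → Set
Splits R T P = SidesWith R T P × SidesWith T R P

module Median {n} {R T P M : Word n} (R-lin : IsLinOrd R) (T-lin : IsLinOrd T) (M-lin : IsLinOrd M)
  (M-majority : ∀ x y → precedes M x y ≡ majorityOf R T P x y) where

  between : ∀ {x y} → precedes R x y ≡ true → precedes M y x ≡ true → precedes T y x ≡ true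
  between {x} {y} Rxy Myx = majority-falseˡ (precedes T y x) (precedes P y x)
    (subst (λ b → majority b (precedes T y x) (precedes P y x) ≡ true) (precedes-asym R-lin Rxy)
           (trans (sym (M-majority y x)) Myx))

  closer : SidesWith R T P → inversions M R < inversions T R
  closer (x , y , Rxy , Txy , Pxy) = inversions-strict M T
    (AllPairs.map between (AllPairs-precedes (proj₁ R-lin)))
    Rxy (precedes-asym M-lin Mxy) (trans (precedes-flip T-lin (precedes-≢ (proj₁ R-lin) Rxy)) (cong not Txy))
    where
    Mxy : precedes M x y ≡ true
    Mxy rewrite M-majority x y | Rxy | Txy | Pxy = refl

  differs : SidesWith T R P → R ≢ M
  differs (x , y , Txy , Rxy , Pxy) R≡M =
    contradiction (trans (sym Rxy) (trans (cong (λ V → precedes V x y) R≡M) Mxy)) λ ()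
    where
    Mxy : precedes M x y ≡ true
    Mxy rewrite M-majority x y | Rxy | Txy | Pxy = refl

  toward : (s : AdjacentInversion R M) →
           Σ (AdjacentInversion R T) λ s′ → AdjacentInversion.swapped s′ ≡ AdjacentInversion.swapped s
  toward (adjacentInversion pre w refl yx) =
    adjacentInversion pre w refl (between (precedes-adjacent pre w (proj₁ R-lin)) yx) , refl

record Finite (A : Set) : Set where
  field
    elements : List A
    complete : ∀ x → x ∈ elements

open Finite {{...}}

module _ {A : Set} {{_ : Finite A}} {P : Pred A 0ℓ} (P? : Decidable P) where

  ∀? : Dec (∀ x → P x)
  ∀? = map′ (λ ps x → All.lookup ps (complete x)) (λ ps → All.tabulate λ {x} _ → ps x) (All.all? P? elements)

  ∃? : Dec (∃ P)
  ∃? = map′ Any.satisfied (λ (x , px) → lose (complete x) px) (Any.any? P? elements)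

data Order3 : Set where
  abc acb bac bca cab cba : Order3

letters : Order3 → Word 3
letters abc = 0F ∷ 1F ∷ 2F ∷ []
letters acb = 0F ∷ 2F ∷ 1F ∷ []
letters bac = 1F ∷ 0F ∷ 2F ∷ []
letters bca = 1F ∷ 2F ∷ 0F ∷ []
letters cab = 2F ∷ 0F ∷ 1F ∷ []
letters cba = 2F ∷ 1F ∷ 0F ∷ []

data End : Set where
  top bottom : End

position : End → ℕ
position top    = 1
position bottom = 3

-- (i , e) stands for the never-condition "the i-th element of the triple is never at end e",
-- i.e. x N 1 or x N 3.
Condition : Set
Condition = Fin 3 × End

AtEnd : ∀ {n} → Word n → Fin n → End → Set
AtEnd w x e = atPos w (position e) ≡ just x

atEnd? : ∀ {n} w x e → Dec (AtEnd {n} w x e)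
atEnd? w x e = Maybeₚ.≡-dec _≟_ (atPos w (position e)) (just x)

Avoids : Word 3 → Condition → Set
Avoids w (i , e) = ¬ AtEnd w i e

instance
  Fin-finite : ∀ {n} → Finite (Fin n)
  Fin-finite {n} = record { elements = allFin n ; complete = ∈-allFin }

  End-finite : Finite End
  End-finite = record
    { elements = top ∷ bottom ∷ []
    ; complete = λ { top → here refl ; bottom → there (here refl) }
    }

  ×-finite : ∀ {A B : Set} {{_ : Finite A}} {{_ : Finite B}} → Finite (A × B)
  ×-finite = record
    { elements = cartesianProduct elements elements
    ; complete = λ (x , y) → ∈-cartesianProduct⁺ (complete x) (complete y)
    }

  Order3-finite : Finite Order3
  Order3-finite = record
    { elements = abc ∷ acb ∷ bac ∷ bca ∷ cab ∷ cba ∷ []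
    ; complete = λ where
        abc → here refl
        acb → there (here refl)
        bac → there (there (here refl))
        bca → there (there (there (here refl)))
        cab → there (there (there (there (here refl))))
        cba → there (there (there (there (there (here refl)))))
    }

module _ (w : Word 3) where

  avoids? : ∀ c → Dec (Avoids w c)
  avoids? (i , e) = ¬? (atEnd? w i e)

  precedes? : ∀ x y b → Dec (precedes w x y ≡ b)
  precedes? x y b = precedes w x y Boolₚ.≟ b

sidesWith? : ∀ R T P → Dec (SidesWith {3} R T P)
sidesWith? R T P =
  ∃? λ x → ∃? λ y → precedes? R x y true ×-dec precedes? T x y false ×-dec precedes? P x y true

-- Each lemma is proved by evaluating a decision procedure over all orders of a triple; the block is
-- abstract so that the evaluation is not replayed where the lemmas are used.
abstract
  majority-transitive : ∀ c r t p → Avoids (letters r) c → Avoids (letters t) c → Avoids (letters p) c →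
    majorityOf (letters r) (letters t) (letters p) 0F 1F ≡ true →
    majorityOf (letters r) (letters t) (letters p) 1F 2F ≡ true →
    majorityOf (letters r) (letters t) (letters p) 0F 2F ≡ true
  majority-transitive = from-yes
    (∀? λ c → ∀? λ r → ∀? λ t → ∀? λ p → let maj = majorityOf (letters r) (letters t) (letters p) in
      avoids? (letters r) c →-dec avoids? (letters t) c →-dec avoids? (letters p) c →-dec
      (maj 0F 1F Boolₚ.≟ true) →-dec (maj 1F 2F Boolₚ.≟ true) →-dec (maj 0F 2F Boolₚ.≟ true))

  majority-avoids : ∀ c r t p m → Avoids (letters r) c → Avoids (letters t) c → Avoids (letters p) c →
    (∀ x y → precedes (letters m) x y ≡ majorityOf (letters r) (letters t) (letters p) x y) →
    Avoids (letters m) c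
  majority-avoids = from-yes
    (∀? λ c → ∀? λ r → ∀? λ t → ∀? λ p → ∀? λ m →
      avoids? (letters r) c →-dec avoids? (letters t) c →-dec avoids? (letters p) c →-dec
      (∀? λ x → ∀? λ y → precedes? (letters m) x y (majorityOf (letters r) (letters t) (letters p) x y)) →-dec
      avoids? (letters m) c)

  blocking : ∀ c₀ r t r′ → Avoids (letters r) c₀ → Avoids (letters t) c₀ →
    (∀ x y → precedes (letters r′) x y ≡ precedes (letters r) x y
           ⊎ precedes (letters r) x y ≢ precedes (letters t) x y) →
    Avoids (letters r′) c₀ ⊎
    ∃[ c₁ ] (Avoids (letters r′) c₁ ×
             ∀ q → Avoids (letters q) c₀ → ¬ Avoids (letters q) c₁ →
                   Splits (letters r) (letters t) (letters q))
  blocking = from-yes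
    (∀? λ c₀ → ∀? λ r → ∀? λ t → ∀? λ r′ →
      avoids? (letters r) c₀ →-dec avoids? (letters t) c₀ →-dec
      (∀? λ x → ∀? λ y → precedes? (letters r′) x y (precedes (letters r) x y)
                          ⊎-dec ¬? (precedes? (letters r) x y (precedes (letters t) x y))) →-dec
      (avoids? (letters r′) c₀ ⊎-dec
       ∃? λ c₁ → avoids? (letters r′) c₁ ×-dec
                 ∀? λ q → avoids? (letters q) c₀ →-dec ¬? (avoids? (letters q) c₁) →-dec
                          (sidesWith? (letters r) (letters t) (letters q) ×-dec
                           sidesWith? (letters t) (letters r) (letters q))))

atPos-map : ∀ {m n} (f : Fin m → Fin n) w k → atPos (map f w) k ≡ Maybe.map f (atPos w k)
atPos-map f []      k             = refl
atPos-map f (x ∷ w) zero          = refl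
atPos-map f (x ∷ w) (suc zero)    = refl
atPos-map f (x ∷ w) (suc (suc k)) = atPos-map f w (suc k)

pick : ∀ {n} → Fin n → Fin n → Fin n → Fin 3 → Fin n
pick a b c 0F = a
pick a b c 1F = b
pick a b c 2F = c

module _ {n : ℕ} (D : Domain n) (a b c : Fin n) where

  Holds : Condition → Set
  Holds (i , e) = NeverAt D a b c (pick a b c i) (position e)

  Violated : Condition → Set
  Violated (i , e) = ∃[ Q ] (Q ∈ D × AtEnd (restrict (a ∷ b ∷ c ∷ []) Q) (pick a b c i) e)

  holds-or-violated : ∀ cond → Holds cond ⊎ Violated cond
  holds-or-violated (i , e) with Any.any? (λ Q → atEnd? (restrict (a ∷ b ∷ c ∷ []) Q) (pick a b c i) e) D
  ... | yes violated = inj₂ (find violated)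
  ... | no ¬violated = inj₁ λ Q Q∈D at → ¬violated (lose Q∈D at)

  holds? : ∀ cond → Dec (Holds cond)
  holds? cond with holds-or-violated cond
  ... | inj₁ holds          = yes holds
  ... | inj₂ (Q , Q∈D , at) = no λ holds → holds Q Q∈D at

  PeakPitOn : Set
  PeakPitOn = ∃[ x ] ((x ≡ a ⊎ x ≡ b ⊎ x ≡ c) × (NeverAt D a b c x 1 ⊎ NeverAt D a b c x 3))

  peakPitOn⇒holds : PeakPitOn → ∃ Holds
  peakPitOn⇒holds (_ , inj₁ refl        , inj₁ never) = (0F , top)    , never
  peakPitOn⇒holds (_ , inj₁ refl        , inj₂ never) = (0F , bottom) , never
  peakPitOn⇒holds (_ , inj₂ (inj₁ refl) , inj₁ never) = (1F , top)    , never
  peakPitOn⇒holds (_ , inj₂ (inj₁ refl) , inj₂ never) = (1F , bottom) , never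
  peakPitOn⇒holds (_ , inj₂ (inj₂ refl) , inj₁ never) = (2F , top)    , never
  peakPitOn⇒holds (_ , inj₂ (inj₂ refl) , inj₂ never) = (2F , bottom) , never

  holds⇒peakPitOn : ∃ Holds → PeakPitOn
  holds⇒peakPitOn ((0F , top)    , never) = a , inj₁ refl        , inj₁ never
  holds⇒peakPitOn ((0F , bottom) , never) = a , inj₁ refl        , inj₂ never
  holds⇒peakPitOn ((1F , top)    , never) = b , inj₂ (inj₁ refl) , inj₁ never
  holds⇒peakPitOn ((1F , bottom) , never) = b , inj₂ (inj₁ refl) , inj₂ never
  holds⇒peakPitOn ((2F , top)    , never) = c , inj₂ (inj₂ refl) , inj₁ never
  holds⇒peakPitOn ((2F , bottom) , never) = c , inj₂ (inj₂ refl) , inj₂ never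

peakPit-or-blocked : ∀ {n} (D : Domain n) →
  PeakPit D ⊎ ∃[ a ] ∃[ b ] ∃[ c ] (a ≢ b × a ≢ c × b ≢ c × ∀ cond → ¬ Holds D a b c cond)
peakPit-or-blocked D = case ∃? (λ a → ∃? λ b → ∃? λ c → blocked? a b c) of λ where
    (yes (a , b , c , a≢b , a≢c , b≢c , none)) →
      inj₂ (a , b , c , a≢b , a≢c , b≢c , λ cond h → none (cond , h))
    (no ¬blocked) → inj₁ λ a b c a≢b a≢c b≢c → holds⇒peakPitOn D a b c
      (decidable-stable (∃? (holds? D a b c)) λ none → ¬blocked (a , b , c , a≢b , a≢c , b≢c , none))
  where
  blocked? : ∀ a b c → Dec (a ≢ b × a ≢ c × b ≢ c × ¬ ∃ (Holds D a b c))
  blocked? a b c = ¬? (a ≟ b) ×-dec ¬? (a ≟ c) ×-dec ¬? (b ≟ c) ×-dec ¬? (∃? (holds? D a b c))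

record Triple (n : ℕ) : Set where
  constructor triple
  field
    {a b c} : Fin n
    a≢b : a ≢ b
    a≢c : a ≢ c
    b≢c : b ≢ c

  members : List (Fin n)
  members = a ∷ b ∷ c ∷ []

  select : Fin 3 → Fin n
  select = pick a b c

  select-injective : Injective _≡_ _≡_ select
  select-injective {0F} {0F} _ = refl
  select-injective {0F} {1F} e = contradiction e a≢b
  select-injective {0F} {2F} e = contradiction e a≢c
  select-injective {1F} {0F} e = contradiction (sym e) a≢b
  select-injective {1F} {1F} _ = refl
  select-injective {1F} {2F} e = contradiction e b≢c
  select-injective {2F} {0F} e = contradiction (sym e) a≢c
  select-injective {2F} {1F} e = contradiction (sym e) b≢c
  select-injective {2F} {2F} _ = refl

  ∈-members : ∀ i → select i ∈ members
  ∈-members 0F = here refl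
  ∈-members 1F = there (here refl)
  ∈-members 2F = there (there (here refl))

  private
    unique-singleton : ∀ {d W} → Unique W → (∀ {z} → z ∈ W → z ≡ d) → d ∈ W → W ≡ d ∷ []
    unique-singleton {W = z ∷ []}    _               only-d _ = cong (_∷ []) (only-d (here refl))
    unique-singleton {W = z ∷ y ∷ _} ((z≢y ∷ _) ∷ _) only-d _ =
      contradiction (trans (only-d (here refl)) (sym (only-d (there (here refl))))) z≢y

    unique-pair : ∀ {d e W} → d ≢ e → Unique W → (∀ {z} → z ∈ W → z ≡ d ⊎ z ≡ e) →
                  d ∈ W → e ∈ W → W ≡ d ∷ e ∷ [] ⊎ W ≡ e ∷ d ∷ []
    unique-pair {d} {e} {z ∷ W} d≢e (z≢W ∷ W!) only-de d∈ e∈ with only-de (here refl)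
    ... | inj₁ refl = inj₁ (cong (d ∷_) (unique-singleton W! only-e (Any.tail (d≢e ∘ sym) e∈)))
      where
      only-e : ∀ {y} → y ∈ W → y ≡ e
      only-e y∈ = [ (λ { refl → contradiction refl (All.lookup z≢W y∈) }) , id ]′ (only-de (there y∈))
    ... | inj₂ refl = inj₂ (cong (e ∷_) (unique-singleton W! only-d (Any.tail d≢e d∈)))
      where
      only-d : ∀ {y} → y ∈ W → y ≡ d
      only-d y∈ = [ id , (λ { refl → contradiction refl (All.lookup z≢W y∈) }) ]′ (only-de (there y∈))

  classify : ∀ {W} → Unique W → (∀ {z} → z ∈ W → z ∈ members) → a ∈ W → b ∈ W → c ∈ W →
             ∃[ r ] W ≡ map select (letters r)
  classify {z ∷ W} (z≢W ∷ W!) ⊆members a∈ b∈ c∈ with ⊆members (here refl)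
  ... | here refl with unique-pair b≢c W! (λ y∈ → others (⊆members (there y∈)) (All.lookup z≢W y∈))
                         (Any.tail (a≢b ∘ sym) b∈) (Any.tail (a≢c ∘ sym) c∈)
    where
    others : ∀ {y} → y ∈ members → a ≢ y → y ≡ b ⊎ y ≡ c
    others (here refl)                 a≢y = contradiction refl a≢y
    others (there (here refl))         _   = inj₁ refl
    others (there (there (here refl))) _   = inj₂ refl
  ...   | inj₁ refl = abc , refl
  ...   | inj₂ refl = acb , refl
  classify {z ∷ W} (z≢W ∷ W!) ⊆members a∈ b∈ c∈ | there (here refl)
    with unique-pair a≢c W! (λ y∈ → others (⊆members (there y∈)) (All.lookup z≢W y∈))
                     (Any.tail a≢b a∈) (Any.tail (b≢c ∘ sym) c∈)
    where
    others : ∀ {y} → y ∈ members → b ≢ y → y ≡ a ⊎ y ≡ c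
    others (here refl)                 _   = inj₁ refl
    others (there (here refl))         b≢y = contradiction refl b≢y
    others (there (there (here refl))) _   = inj₂ refl
  ...   | inj₁ refl = bac , refl
  ...   | inj₂ refl = bca , refl
  classify {z ∷ W} (z≢W ∷ W!) ⊆members a∈ b∈ c∈ | there (there (here refl))
    with unique-pair a≢b W! (λ y∈ → others (⊆members (there y∈)) (All.lookup z≢W y∈))
                     (Any.tail a≢c a∈) (Any.tail b≢c b∈)
    where
    others : ∀ {y} → y ∈ members → c ≢ y → y ≡ a ⊎ y ≡ b
    others (here refl)                 _   = inj₁ refl
    others (there (here refl))         _   = inj₂ refl
    others (there (there (here refl))) c≢y = contradiction refl c≢y
  ...   | inj₁ refl = cab , refl
  ...   | inj₂ refl = cba , refl

  restriction : ∀ {R} → IsLinOrd R → ∃[ r ] restrict members R ≡ map select (letters r)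
  restriction {R} (R! , ∈R) = classify (Uniqueₚ.filter⁺ _ R!) (proj₂ ∘ ∈-filter⁻ _ {xs = R})
    (∈-filter⁺ _ (∈R a) (∈-members 0F)) (∈-filter⁺ _ (∈R b) (∈-members 1F))
    (∈-filter⁺ _ (∈R c) (∈-members 2F))

  code : ∀ {R} → IsLinOrd R → Order3
  code R-lin = proj₁ (restriction R-lin)

  module _ {R : Word n} (R-lin : IsLinOrd R) where
    open ≡-Reasoning

    private
      r = letters (code R-lin)

    precedes-code : ∀ i j → precedes R (select i) (select j) ≡ precedes r i j
    precedes-code i j = begin
      precedes R (select i) (select j)                    ≡⟨ precedes-filter _ R (∈-members i) (∈-members j) ⟨
      precedes (restrict members R) (select i) (select j) ≡⟨ cong (λ w → precedes w (select i) (select j))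
                                                                  (proj₂ (restriction R-lin)) ⟩
      precedes (map select r) (select i) (select j)       ≡⟨ precedes-map select-injective r ⟩
      precedes r i j                                      ∎

    atPos-code : ∀ k → atPos (restrict members R) k ≡ Maybe.map select (atPos r k)
    atPos-code k = trans (cong (λ w → atPos w k) (proj₂ (restriction R-lin))) (atPos-map select r k)

    atEnd-code : ∀ i e → AtEnd (restrict members R) (select i) e → AtEnd r i e
    atEnd-code i e at = Maybeₚ.map-injective select-injective (trans (sym (atPos-code (position e))) at)

    atEnd-code⁻ : ∀ i e → AtEnd r i e → AtEnd (restrict members R) (select i) e
    atEnd-code⁻ i e at = trans (atPos-code (position e)) (cong (Maybe.map select) at)

    holds⇒avoids : ∀ {D} cond → Holds D a b c cond → R ∈ D → Avoids r cond
    holds⇒avoids (i , e) holds R∈D at = holds R R∈D (atEnd-code⁻ i e at)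

    holds-∷ : ∀ {D} cond → Holds D a b c cond → Avoids r cond → Holds (R ∷ D) a b c cond
    holds-∷ (i , e) _     avoids _ (here refl) at = avoids (atEnd-code i e at)
    holds-∷ (i , e) holds _      Q (there Q∈D)    = holds Q Q∈D

  module _ {R T P : Word n} (R-lin : IsLinOrd R) (T-lin : IsLinOrd T) (P-lin : IsLinOrd P) where

    majority-code : ∀ i j → majorityOf R T P (select i) (select j) ≡
                            majorityOf (letters (code R-lin)) (letters (code T-lin)) (letters (code P-lin)) i j
    majority-code i j rewrite precedes-code R-lin i j | precedes-code T-lin i j | precedes-code P-lin i j = refl

    sidesWith-code : SidesWith (letters (code R-lin)) (letters (code T-lin)) (letters (code P-lin)) → SidesWith R T P
    sidesWith-code (i , j , Rij , Tij , Pij) =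
      select i , select j , trans (precedes-code R-lin i j) Rij , trans (precedes-code T-lin i j) Tij ,
      trans (precedes-code P-lin i j) Pij

module MaximalPeakPitDomain {n : ℕ} (D : Domain n) (linear : All IsLinOrd D) (D-max : MaximalPeakPit D) where

  linear∈ : ∀ {R} → R ∈ D → IsLinOrd R
  linear∈ = All.lookup linear

  condition : (t : Triple n) → ∃ (Holds D (Triple.a t) (Triple.b t) (Triple.c t))
  condition t = peakPitOn⇒holds D a b c (proj₁ D-max a b c a≢b a≢c b≢c)
    where open Triple t

  avoids-condition : ∀ t {R} (R∈D : R ∈ D) →
                     Avoids (letters (Triple.code t (linear∈ R∈D))) (proj₁ (condition t))
  avoids-condition t R∈D = Triple.holds⇒avoids t (linear∈ R∈D) _ (proj₂ (condition t)) R∈D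

  ∈-by-maximality : ∀ {R} → IsLinOrd R → PeakPit (R ∷ D) → R ∈ D
  ∈-by-maximality {R} R-lin pp = proj₂ D-max (R ∷ D) (R-lin ∷ linear) pp there (here refl)

  ∈-if-avoids-conditions : ∀ {R} (R-lin : IsLinOrd R) →
                           (∀ t → Avoids (letters (Triple.code t R-lin)) (proj₁ (condition t))) → R ∈ D
  ∈-if-avoids-conditions R-lin avoids = ∈-by-maximality R-lin λ a b c a≢b a≢c b≢c →
    let t = triple a≢b a≢c b≢c
        cond , holds = condition t
    in holds⇒peakPitOn (_ ∷ D) a b c (cond , Triple.holds-∷ t R-lin cond holds (avoids t))

  median : ∀ {R T P} → R ∈ D → T ∈ D → P ∈ D →
           ∃[ M ] (M ∈ D × ∀ x y → precedes M x y ≡ majorityOf R T P x y)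
  median {R} {T} {P} R∈D T∈D P∈D = linearisation , M∈D , precedes-linearisation
    where
    R-lin = linear∈ R∈D
    T-lin = linear∈ T∈D
    P-lin = linear∈ P∈D
    lt = majorityOf R T P

    lt-irrefl : ∀ x → lt x x ≡ false
    lt-irrefl x rewrite precedes-irrefl x (proj₁ R-lin) | precedes-irrefl x (proj₁ T-lin) = refl

    lt-flip : ∀ {x y} → x ≢ y → lt y x ≡ not (lt x y)
    lt-flip {x} {y} x≢y rewrite precedes-flip R-lin x≢y | precedes-flip T-lin x≢y | precedes-flip P-lin x≢y =
      majority-not (precedes R x y) (precedes T x y) (precedes P x y)

    lt-trans : ∀ {x y z} → lt x y ≡ true → lt y z ≡ true → lt x z ≡ true
    lt-trans {x} {y} {z} xy yz with x ≟ y | y ≟ z | x ≟ z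
    ... | yes refl | _        | _        = contradiction (trans (sym xy) (lt-irrefl x)) λ ()
    ... | no _     | yes refl | _        = contradiction (trans (sym yz) (lt-irrefl y)) λ ()
    ... | no x≢y   | no _     | yes refl = contradiction (trans (sym yz) (trans (lt-flip x≢y) (cong not xy))) λ ()
    ... | no x≢y   | no y≢z   | no x≢z   =
      let t = triple x≢y x≢z y≢z
          open Triple t
      in trans (majority-code R-lin T-lin P-lin 0F 2F)
           (majority-transitive (proj₁ (condition t)) (code R-lin) (code T-lin) (code P-lin)
             (avoids-condition t R∈D) (avoids-condition t T∈D) (avoids-condition t P∈D)
             (trans (sym (majority-code R-lin T-lin P-lin 0F 1F)) xy)
             (trans (sym (majority-code R-lin T-lin P-lin 1F 2F)) yz))

    open Linearisation lt lt-irrefl lt-flip lt-trans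

    M∈D : linearisation ∈ D
    M∈D = ∈-if-avoids-conditions linearisation-linear λ t →
      let open Triple t
      in majority-avoids (proj₁ (condition t)) (code R-lin) (code T-lin) (code P-lin) (code linearisation-linear)
           (avoids-condition t R∈D) (avoids-condition t T∈D) (avoids-condition t P∈D)
           λ i j → trans (sym (precedes-code linearisation-linear i j))
                     (trans (precedes-linearisation (select i) (select j)) (majority-code R-lin T-lin P-lin i j))

  module _ {R T : Word n} (R∈D : R ∈ D) (T∈D : T ∈ D) (s : AdjacentInversion R T) where
    open AdjacentInversion s using (swapped)

    private
      R-lin = linear∈ R∈D
      T-lin = linear∈ T∈D
      R′-lin = swapped-linear R-lin s

    module _ (t : Triple n) where
      open Triple t

      private
        c₀ = proj₁ (condition t)
        holds₀ = proj₂ (condition t)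

        flips : ∀ i j → precedes (letters (code R′-lin)) i j ≡ precedes (letters (code R-lin)) i j
                      ⊎ precedes (letters (code R-lin)) i j ≢ precedes (letters (code T-lin)) i j
        flips i j = Sum.map
          (λ same → trans (sym (precedes-code R′-lin i j)) (trans same (precedes-code R-lin i j)))
          (λ differ eq → differ (trans (precedes-code R-lin i j) (trans eq (sym (precedes-code T-lin i j)))))
          (swap-changes-only-disagreements R-lin T-lin s (select i) (select j))

      blocked-split : (∀ cond → ¬ Holds (swapped ∷ D) a b c cond) → ∃[ P ] (P ∈ D × Splits R T P)
      blocked-split blocked
        with blocking c₀ (code R-lin) (code T-lin) (code R′-lin)
                      (avoids-condition t R∈D) (avoids-condition t T∈D) flips
      ... | inj₁ avoids₀ = contradiction (holds-∷ R′-lin c₀ holds₀ avoids₀) (blocked c₀)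
      ... | inj₂ (c₁ , avoids₁ , splitting) with holds-or-violated D a b c c₁
      ...   | inj₁ holds₁ = contradiction (holds-∷ R′-lin c₁ holds₁ avoids₁) (blocked c₁)
      ...   | inj₂ (Q , Q∈D , at) =
        let Q-lin = linear∈ Q∈D
            sides-R , sides-T = splitting (code Q-lin) (avoids-condition t Q∈D)
                                          (λ avoids → avoids (atEnd-code Q-lin _ _ at))
        in Q , Q∈D , sidesWith-code R-lin T-lin Q-lin sides-R , sidesWith-code T-lin R-lin Q-lin sides-T

    swap-or-split : swapped ∈ D ⊎ ∃[ P ] (P ∈ D × Splits R T P)
    swap-or-split with peakPit-or-blocked (swapped ∷ D)
    ... | inj₁ pp = inj₁ (∈-by-maximality R′-lin pp)
    ... | inj₂ (a , b , c , a≢b , a≢c , b≢c , blocked) = inj₂ (blocked-split (triple a≢b a≢c b≢c) blocked)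

  StepWithin : Word n → Word n → Set
  StepWithin R T = Σ (AdjacentInversion R T) λ s → AdjacentInversion.swapped s ∈ D

  step-toward : ∀ {R T} → R ∈ D → T ∈ D → R ≢ T → StepWithin R T
  step-toward R∈D T∈D = bounded _ ≤-refl R∈D T∈D
    where
    bounded : ∀ k {R T} → inversions T R < k → R ∈ D → T ∈ D → R ≢ T → StepWithin R T
    bounded (suc k) bound R∈D T∈D R≢T
      with R-lin ← linear∈ R∈D | T-lin ← linear∈ T∈D
      with s ← adjacent-inversion (proj₁ R-lin) (proj₁ T-lin)
                                  (λ {z} _ → proj₂ T-lin z) (λ {z} _ → proj₂ R-lin z) R≢T
      with swap-or-split R∈D T∈D s
    ... | inj₁ s∈D = s , s∈D
    ... | inj₂ (P , P∈D , sides-R , sides-T) =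
      let M , M∈D , M-majority = median R∈D T∈D P∈D
          open Median {P = P} R-lin T-lin (linear∈ M∈D) M-majority
          s′ , s′∈D = bounded k (≤-trans (closer sides-R) (≤-pred bound)) R∈D M∈D (differs sides-T)
          s″ , same = toward s′
      in s″ , subst (_∈ D) (sym same) s′∈D

  PathWithin : Word n → Word n → ℕ → Set
  PathWithin R T k = ∃[ ps ] (IsPath R T ps × length ps ≡ suc k × All (_∈ D) ps)

  path-within : ∀ {R T} → R ∈ D → T ∈ D → PathWithin R T (inversions T R)
  path-within {T = T} R∈D T∈D = go _ R∈D refl
    where
    T-lin = linear∈ T∈D
    go : ∀ k {R} → R ∈ D → inversions T R ≡ k → PathWithin R T k
    go k {R} R∈D R-inv with ≡-dec _≟_ R T
    ... | yes refl =
      R ∷ [] , (single R , refl , refl) , cong suc (trans (sym (inversions-self T-lin)) R-inv) , R∈D ∷ []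
    ... | no R≢T with step-toward R∈D T∈D R≢T
    ...   | s , s∈D with k | inversions-swapped T-lin s
    ...     | zero  | R-inv′ = contradiction (trans (sym R-inv′) R-inv) λ ()
    ...     | suc k | R-inv′ with go k s∈D (suc-injective (trans (sym R-inv′) R-inv))
    ...       | S ∷ ps , (chain , refl , last≡T) , len , within =
      R ∷ S ∷ ps , (step (alike-swapped (linear∈ R∈D) s) chain , refl , last≡T) ,
      cong suc len , R∈D ∷ within

  directlyConnected : DirectlyConnected D
  directlyConnected R T R∈D T∈D =
    let ps , path , len , within = path-within R∈D T∈D
    in ps , (path , λ qs qs-path → subst (_≤ length qs) (sym len) (path-length (linear∈ T∈D) qs-path)) , within

theorem1 : ∀ (n : ℕ) (D : Domain n) → All IsLinOrd D →
    MaximalPeakPit D → DirectlyConnected D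
theorem1 n D linear D-max = MaximalPeakPitDomain.directlyConnected D linear D-max
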